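{- Let $G$ be a finite simple graph with no isolated vertices. Then $h(G)\le |E(G)|+p(G)$. In addition, if there exists a spanning subgraph $G'$ of $G$ with no isolated vertices such that the line graph $L(G')$ is Hamiltonian, then $G$ is single-headed, i.e. $h(G)=|E(G)|$.
   Context: A directed 3-hypergraph $H=(V,F)$ consists of hyperarcs written $u,v\to w$, where $\{u,v\}$ (two distinct vertices) is the body and $w$ is the head. For $S\subseteq V$, the closure $cl_H(S)$ is the set of vertices marked by forward chaining: mark all vertices of $S$; while there is a hyperarc $a,b\to c$ in $F$ with $a,b$ marked and $c$ unmarked, mark $c$. $H$ represents the undirected graph $G=(V,E)$ if for all distinct $u,v\in V$: $(u,v)\in E$ implies $cl_H(\{u,v\})=V$, and $(u,v)\notin E$ implies $cl_H(\{u,v\})=\{u,v\}$. The hydra number $h(G)$ is the minimum of $|F|$ over all directed 3-hypergraphs $H=(V,F)$ representing $G$. $G$ is single-headed if $h(G)=|E(G)|$. The line graph $L(G)$ has vertex set $E(G)$, two distinct edges adjacent iff they share an endpoint. A spanning subgraph of $G$ has the same vertex set and a subset of the edges (it need not be connected). $pcn(X)$ is the minimum number of vertex-disjoint paths covering all vertices of a graph $X$. $p(G)=\min\{pcn(L(G')) : G' \text{ a spanning subgraph of } G \text{ with no isolated vertices}\}$. -}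

module Defs where

open import Data.Nat using (ℕ; _≤_; _+_)
open import Data.Fin using (Fin) renaming (_<_ to _<ᶠ_)
open import Data.Product using (Σ; ∃; _×_; _,_; proj₁; proj₂)
open import Data.Sum using (_⊎_)
open import Data.List using (List; []; _∷_; length; concat; _∷ʳ_)
open import Data.List.Membership.Propositional using (_∈_)
open import Data.List.Relation.Unary.All using (All)
open import Data.List.Relation.Unary.Linked using (Linked)
open import Data.List.Relation.Unary.Unique.Propositional using (Unique)
open import Data.List.Relation.Binary.Permutation.Propositional using (_↭_)
open import Relation.Binary.PropositionalEquality using (_≡_; _≢_)
open import Relation.Nullary using (¬_)

-- Finite simple graphs on vertex set Fin n.
-- An (undirected) edge {i,j} is stored canonically as the pair (i , j)
-- with i < j; the edge set is a duplicate-free list of such pairs.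

Edge : ℕ → Set
Edge n = Fin n × Fin n

record Graph (n : ℕ) : Set where
  field
    edges   : List (Edge n)
    ordered : All (λ e → proj₁ e <ᶠ proj₂ e) edges
    unique  : Unique edges
open Graph public

∣E∣ : ∀ {n} → Graph n → ℕ
∣E∣ G = length (edges G)

Adjacent : ∀ {n} → Graph n → Fin n → Fin n → Set
Adjacent G u v = (u , v) ∈ edges G ⊎ (v , u) ∈ edges G

NoIsolated : ∀ {n} → Graph n → Set
NoIsolated {n} G = (v : Fin n) → ∃ λ w → Adjacent G v w

SpanningSubgraph : ∀ {n} → Graph n → Graph n → Set
SpanningSubgraph G G' = All (λ e → e ∈ edges G) (edges G')

-- Directed 3-hypergraphs on Fin n.
-- A hyperarc a,b → c (body {a,b}, a ≠ b) is stored canonically as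
-- (a , b , c) with a < b; the hyperarc set is a duplicate-free list.

Hyperarc : ℕ → Set
Hyperarc n = Fin n × Fin n × Fin n

record Hypergraph (n : ℕ) : Set where
  field
    arcs      : List (Hyperarc n)
    arcsOrd   : All (λ t → proj₁ t <ᶠ proj₁ (proj₂ t)) arcs
    arcsUniq  : Unique arcs
open Hypergraph public

-- Forward-chaining closure cl_H(S): the least set containing S and closed
-- under the hyperarcs of H (exactly the set of marked vertices).
data Closure {n : ℕ} (H : Hypergraph n) (S : Fin n → Set) : Fin n → Set where
  base : ∀ {x} → S x → Closure H S x
  step : ∀ {a b c} → (a , b , c) ∈ arcs H →
         Closure H S a → Closure H S b → Closure H S c

Pair : ∀ {n} → Fin n → Fin n → Fin n → Set
Pair u v x = x ≡ u ⊎ x ≡ v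

Represents : ∀ {n} → Hypergraph n → Graph n → Set
Represents {n} H G = (u v : Fin n) → u ≢ v →
    (Adjacent G u v → (x : Fin n) → Closure H (Pair u v) x)
  × (¬ Adjacent G u v → (x : Fin n) → Closure H (Pair u v) x → Pair u v x)

IsHydraNumber : ∀ {n} → Graph n → ℕ → Set
IsHydraNumber {n} G h =
    (∃ λ (H : Hypergraph n) → Represents H G × length (arcs H) ≡ h)
  × ((H : Hypergraph n) → Represents H G → h ≤ length (arcs H))

PathCover : ∀ {V : Set} → List V → (V → V → Set) → ℕ → Set
PathCover {V} vs Adj k =
  ∃ λ (ps : List (List V)) →
      length ps ≡ k
    × All (λ p → p ≢ []) ps
    × All (Linked Adj) ps
    × (concat ps ↭ vs)

IsPathCoverNumber : ∀ {V : Set} → List V → (V → V → Set) → ℕ → Set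
IsPathCoverNumber vs Adj k =
  PathCover vs Adj k × (∀ k' → PathCover vs Adj k' → k ≤ k')

Hamiltonian : ∀ {V : Set} → List V → (V → V → Set) → Set
Hamiltonian {V} vs Adj =
  ∃ λ (x : V) → ∃ λ (xs : List V) →
      ((x ∷ xs) ↭ vs)
    × 3 ≤ length (x ∷ xs)
    × Linked Adj ((x ∷ xs) ∷ʳ x)

LineAdj : ∀ {n} → Edge n → Edge n → Set
LineAdj e f = e ≢ f ×
  (proj₁ e ≡ proj₁ f ⊎ proj₁ e ≡ proj₂ f ⊎ proj₂ e ≡ proj₁ f ⊎ proj₂ e ≡ proj₂ f)

IsPcnLine : ∀ {n} → Graph n → ℕ → Set
IsPcnLine G' k = IsPathCoverNumber (edges G') LineAdj k

HamiltonianLine : ∀ {n} → Graph n → Set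
HamiltonianLine G' = Hamiltonian (edges G') LineAdj

IsP : ∀ {n} → Graph n → ℕ → Set
IsP {n} G p =
    (∃ λ (G' : Graph n) → SpanningSubgraph G G' × NoIsolated G' × IsPcnLine G' p)
  × ((G' : Graph n) → SpanningSubgraph G G' → NoIsolated G' →
       ∀ k → IsPcnLine G' k → p ≤ k)

-- Upper bound: list the edges of G' along the p paths of a path cover of L(G') and close the list
-- into a cycle.  For consecutive edges e, f add the arcs with body e whose heads are the endpoints
-- of f outside e: one arc when e and f share an endpoint, at most two at each of the p junctions.
-- As soon as some edge of G' has both endpoints marked, the marks run around the whole cycle and
-- reach every vertex, G' having no isolated vertex.  An edge ab of G outside G' gets the single
-- arc a,b → w for a G'-neighbour w of a, which hands the marking over to the edge aw of G'.  All
-- bodies are edges of G, so the pair of a non-edge is closed, and the count is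
-- |E(G')| + p + (|E(G)| − |E(G')|).  A Hamiltonian L(G') needs no junction arcs.
--
-- Lower bound (n ≥ 3): from {u, v} the closure must leave {u, v}, and the first arc doing so has
-- body uv; hence every edge is a body and |F| ≥ |E(G)|.
--
-- The hydra number exists because representability with k arcs is decidable (closures are
-- computed by saturation), so a least k is found below any representation.

module Submission where

open import Defs
open import Function using (_∘_; id)
open import Data.Nat using (ℕ; zero; suc; _≤_; _<_; _+_; z≤n; s≤s)
open import Data.Nat.Properties
  using (≤-refl; ≤-trans; ≤-antisym; <⇒≤; ≮⇒≥; ≤-reflexive; +-mono-≤; +-monoˡ-≤; +-monoʳ-≤;
         +-cancelʳ-≤; +-identityʳ; +-comm; +-suc; m≤n+m; m≤m+n; n≤1+n; suc-injective; anyUpTo?; module ≤-Reasoning)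
open import Data.Nat.Induction using (<-wellFounded)
open import Data.Nat.Tactic.RingSolver using (solve-∀)
open import Data.Fin using (Fin; zero; suc; _≟_; _<?_) renaming (_<_ to _<ᶠ_)
open import Data.Fin.Properties using (all?; any?; <-irrefl; <-asym; <⇒≢)
open import Data.Fin.Subset using (Subset; ⁅_⁆; _∪_; _⊂_; _⊃_)
  renaming (_∈_ to _∈ₛ_; _∉_ to _∉ₛ_; _⊆_ to _⊆ₛ_)
open import Data.Fin.Subset.Properties using (p⊆p∪q; x∈p∪q⁺; x∈p∪q⁻; x∈⁅x⁆; x∈⁅y⁆⇒x≡y)
  renaming (_∈?_ to _∈ₛ?_)
open import Data.Fin.Subset.Induction using (⊃-wellFounded)
open import Data.Product using (Σ; ∃; _×_; _,_; proj₁; proj₂)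
open import Data.Product.Properties using (≡-dec)
open import Data.Sum using (_⊎_; inj₁; inj₂; [_,_]′)
import Data.Sum as Sum
open import Data.Empty using (⊥-elim)
open import Data.List using (List; []; _∷_; [_]; length; _++_; _∷ʳ_; concat; map; filter; removeAt; deduplicate)
open import Data.List.Properties using (length-map; length-++; length-removeAt′; length-deduplicate; ++-assoc)
open import Data.List.Membership.Propositional using (_∈_; find; lose)
import Data.List.Membership.DecPropositional
open import Data.List.Membership.Propositional.Properties using (∈-++⁻; ∈-map⁺; ∈-map⁻; ∈-filter⁺; ∈-filter⁻; ∈-deduplicate⁺; ∈-deduplicate⁻)
open import Data.List.Relation.Binary.Subset.Propositional using (_⊆_)
open import Data.List.Relation.Binary.Subset.Propositional.Properties using (xs⊆xs++ys; xs⊆ys++xs)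
open import Data.List.Relation.Unary.Any as Any using (here; there; index)
open import Data.List.Relation.Unary.All as All using (All; []; _∷_)
open import Data.List.Relation.Unary.All.Properties using (++⁻ˡ)
open import Data.List.Relation.Unary.Linked using (Linked; _∷_)
open import Data.List.Relation.Unary.Unique.Propositional using (Unique)
open import Data.List.Relation.Unary.AllPairs using (_∷_)
open import Data.List.Relation.Unary.Unique.DecPropositional using (unique?)
open import Data.List.Relation.Unary.Unique.DecPropositional.Properties using (deduplicate-!)
open import Data.List.Relation.Binary.Permutation.Propositional using (_↭_; ↭-sym)
open import Data.List.Relation.Binary.Permutation.Propositional.Properties using (∈-resp-↭; ↭-length)
open import Induction.WellFounded using (Acc; acc)
open import Relation.Binary.Definitions using (DecidableEquality)
open import Relation.Binary.PropositionalEquality using (_≡_; _≢_; refl; sym; trans; cong)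
open import Relation.Nullary using (¬_; Dec; yes; no)
open import Relation.Nullary.Decidable using (map′; _×-dec_; _⊎-dec_; _→-dec_; ¬?; decidable-stable)
open import Relation.Unary using (Decidable)
open import Relation.Unary.Properties using (∁?)

module _ {A : Set} where

  ∈-removeAt : ∀ {x z : A} {ys} (x∈ys : x ∈ ys) → z ∈ ys → z ≢ x → z ∈ removeAt ys (index x∈ys)
  ∈-removeAt (here x≡y)   (here z≡y)   z≢x = ⊥-elim (z≢x (trans z≡y (sym x≡y)))
  ∈-removeAt (here _)     (there z∈ys) _   = z∈ys
  ∈-removeAt (there _)    (here z≡y)   _   = here z≡y
  ∈-removeAt (there x∈ys) (there z∈ys) z≢x = there (∈-removeAt x∈ys z∈ys z≢x)

  Unique-⊆⇒length≤ : ∀ {xs ys : List A} → Unique xs → xs ⊆ ys → length xs ≤ length ys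
  Unique-⊆⇒length≤ {[]}     _               _     = z≤n
  Unique-⊆⇒length≤ {x ∷ xs} {ys} (x∉xs ∷ uniq) xs⊆ys = begin
    suc (length xs)                         ≤⟨ s≤s (Unique-⊆⇒length≤ uniq xs⊆ys-x) ⟩
    suc (length (removeAt ys (index x∈ys))) ≡⟨ sym (length-removeAt′ ys (index x∈ys)) ⟩
    length ys                               ∎
    where
    open ≤-Reasoning
    x∈ys = xs⊆ys (here refl)
    xs⊆ys-x : xs ⊆ removeAt ys (index x∈ys)
    xs⊆ys-x z∈xs = ∈-removeAt x∈ys (xs⊆ys (there z∈xs)) (λ z≡x → All.lookup x∉xs z∈xs (sym z≡x))

  length-filter+length-filter-∁ : ∀ {P : A → Set} (P? : Decidable P) xs →
    length (filter P? xs) + length (filter (∁? P?) xs) ≡ length xs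
  length-filter+length-filter-∁ P? []       = refl
  length-filter+length-filter-∁ P? (x ∷ xs) with P? x
  ... | yes _ = cong suc (length-filter+length-filter-∁ P? xs)
  ... | no  _ = trans (+-suc _ _) (cong suc (length-filter+length-filter-∁ P? xs))

-- Closures

module _ {n : ℕ} where

  Closure-mono : ∀ {H H' : Hypergraph n} {S T : Fin n → Set} → arcs H ⊆ arcs H' → (∀ {x} → S x → T x) →
                 ∀ {x} → Closure H S x → Closure H' T x
  Closure-mono H⊆H' S⊆T (base s)       = base (S⊆T s)
  Closure-mono H⊆H' S⊆T (step t∈H a b) = step (H⊆H' t∈H) (Closure-mono H⊆H' S⊆T a) (Closure-mono H⊆H' S⊆T b)

  Closed : Hypergraph n → Subset n → Set
  Closed H m = ∀ {a b c} → (a , b , c) ∈ arcs H → a ∈ₛ m → b ∈ₛ m → c ∈ₛ m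

  Closure-least : ∀ {H : Hypergraph n} {S : Fin n → Set} {m} → Closed H m → (∀ {x} → S x → x ∈ₛ m) →
                  ∀ {x} → Closure H S x → x ∈ₛ m
  Closure-least closed S⊆m (base s)       = S⊆m s
  Closure-least closed S⊆m (step t∈H a b) = closed t∈H (Closure-least closed S⊆m a) (Closure-least closed S⊆m b)

  Closure-exit : ∀ {H : Hypergraph n} {S : Fin n → Set} → Decidable S → ∀ {x} → Closure H S x → ¬ S x →
                 ∃ λ a → ∃ λ b → ∃ λ c → (a , b , c) ∈ arcs H × S a × S b × ¬ S c
  Closure-exit S? (base s) ¬s = ⊥-elim (¬s s)
  Closure-exit S? (step {a} {b} {c} t∈H ca cb) ¬sc with S? a | S? b
  ... | no ¬sa | _      = Closure-exit S? ca ¬sa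
  ... | yes _  | no ¬sb = Closure-exit S? cb ¬sb
  ... | yes sa | yes sb = a , b , c , t∈H , sa , sb , ¬sc

module Saturation {n : ℕ} (H : Hypergraph n) (S : Fin n → Set) where

  Sound : Subset n → Set
  Sound m = ∀ {x} → x ∈ₛ m → Closure H S x

  Fires : Subset n → Hyperarc n → Set
  Fires m (a , b , c) = a ∈ₛ m × b ∈ₛ m × c ∉ₛ m

  fires? : ∀ m → Decidable (Fires m)
  fires? m (a , b , c) = (a ∈ₛ? m) ×-dec (b ∈ₛ? m) ×-dec ¬? (c ∈ₛ? m)

  ⊂-∪⁅⁆ : ∀ {m : Subset n} {c} → c ∉ₛ m → m ⊂ m ∪ ⁅ c ⁆
  ⊂-∪⁅⁆ {m} {c} c∉m = p⊆p∪q ⁅ c ⁆ , c , x∈p∪q⁺ (inj₂ (x∈⁅x⁆ c)) , c∉m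

  Sound-∪⁅head⁆ : ∀ {m a b c} → Sound m → (a , b , c) ∈ arcs H → a ∈ₛ m → b ∈ₛ m → Sound (m ∪ ⁅ c ⁆)
  Sound-∪⁅head⁆ {m} {c = c} sound t∈H a∈m b∈m x∈m∪c with x∈p∪q⁻ m ⁅ c ⁆ x∈m∪c
  ... | inj₁ x∈m = sound x∈m
  ... | inj₂ x∈c with refl ← x∈⁅y⁆⇒x≡y c x∈c = step t∈H (sound a∈m) (sound b∈m)

  saturate : ∀ m → Acc _⊃_ m → Sound m → ∃ λ m' → m ⊆ₛ m' × Closed H m' × Sound m'
  saturate m (acc rec) sound with Any.any? (fires? m) (arcs H)
  ... | no stuck = m , id , closed , sound
    where
    closed : Closed H m
    closed {c = c} t∈H a∈m b∈m = decidable-stable (c ∈ₛ? m) λ c∉m → stuck (lose t∈H (a∈m , b∈m , c∉m))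
  ... | yes fire with find fire
  ... | (a , b , c) , t∈H , a∈m , b∈m , c∉m
    with m' , m∪c⊆m' , closed , sound' ← saturate (m ∪ ⁅ c ⁆) (rec (⊂-∪⁅⁆ c∉m)) (Sound-∪⁅head⁆ sound t∈H a∈m b∈m)
    = m' , (λ x∈m → m∪c⊆m' (p⊆p∪q ⁅ c ⁆ x∈m)) , closed , sound'

closure? : ∀ {n} (H : Hypergraph n) (s : Subset n) → Decidable (Closure H (_∈ₛ s))
closure? H s x with m , s⊆m , closed , sound ← Saturation.saturate H (_∈ₛ s) s (⊃-wellFounded s) base
  = map′ sound (Closure-least closed s⊆m) (x ∈ₛ? m)

module _ {n : ℕ} where

  pair? : (u v : Fin n) → Decidable (Pair u v)
  pair? u v x = (x ≟ u) ⊎-dec (x ≟ v)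

  pairClosure? : (H : Hypergraph n) (u v : Fin n) → Decidable (Closure H (Pair u v))
  pairClosure? H u v x = map′ (Closure-mono id from) (Closure-mono id to) (closure? H (⁅ u ⁆ ∪ ⁅ v ⁆) x)
    where
    to : ∀ {y} → Pair u v y → y ∈ₛ ⁅ u ⁆ ∪ ⁅ v ⁆
    to (inj₁ refl) = x∈p∪q⁺ (inj₁ (x∈⁅x⁆ u))
    to (inj₂ refl) = x∈p∪q⁺ (inj₂ (x∈⁅x⁆ v))
    from : ∀ {y} → y ∈ₛ ⁅ u ⁆ ∪ ⁅ v ⁆ → Pair u v y
    from = Sum.map (x∈⁅y⁆⇒x≡y u) (x∈⁅y⁆⇒x≡y v) ∘ x∈p∪q⁻ ⁅ u ⁆ ⁅ v ⁆

  _≟ᴱ_ : DecidableEquality (Edge n)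
  _≟ᴱ_ = ≡-dec _≟_ _≟_

  _≟ᴴ_ : DecidableEquality (Hyperarc n)
  _≟ᴴ_ = ≡-dec _≟_ (≡-dec _≟_ _≟_)

  _∈ᴱ?_ : (e : Edge n) (es : List (Edge n)) → Dec (e ∈ es)
  _∈ᴱ?_ = Data.List.Membership.DecPropositional._∈?_ _≟ᴱ_

  adjacent? : (G : Graph n) (u v : Fin n) → Dec (Adjacent G u v)
  adjacent? G u v = ((u , v) ∈ᴱ? edges G) ⊎-dec ((v , u) ∈ᴱ? edges G)

  represents? : (H : Hypergraph n) (G : Graph n) → Dec (Represents H G)
  represents? H G = all? λ u → all? λ v → ¬? (u ≟ v) →-dec
      ((adjacent? G u v →-dec all? (pairClosure? H u v))
    ×-dec (¬? (adjacent? G u v) →-dec all? λ x → pairClosure? H u v x →-dec pair? u v x))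

  Represents-resp-arcs : ∀ {H H' : Hypergraph n} {G} → arcs H ⊆ arcs H' → arcs H' ⊆ arcs H →
                         Represents H G → Represents H' G
  Represents-resp-arcs H⊆H' H'⊆H rep u v u≢v =
      (λ adj x → Closure-mono H⊆H' id (proj₁ (rep u v u≢v) adj x))
    , (λ ¬adj x cl → proj₂ (rep u v u≢v) ¬adj x (Closure-mono H'⊆H id cl))

-- Existence of the hydra number

anyHyperarc? : ∀ {n} {P : Hyperarc n → Set} → Decidable P → Dec (∃ P)
anyHyperarc? P? = map′ (λ (a , b , c , p) → (a , b , c) , p) (λ ((a , b , c) , p) → a , b , c , p)
  (any? λ a → any? λ b → any? λ c → P? (a , b , c))

anyOfLength? : ∀ {A : Set} → (∀ {P : A → Set} → Decidable P → Dec (∃ P)) →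
               ∀ k {Q : List A → Set} → Decidable Q → Dec (∃ λ xs → length xs ≡ k × Q xs)
anyOfLength? anyA? zero    Q? = map′ (λ q → [] , refl , q) (λ { ([] , refl , q) → q }) (Q? [])
anyOfLength? anyA? (suc k) Q? =
  map′ (λ (x , xs , len , q) → x ∷ xs , cong suc len , q) (λ { (x ∷ xs , len , q) → x , xs , suc-injective len , q })
    (anyA? λ x → anyOfLength? anyA? k (Q? ∘ (x ∷_)))

RepresentableBy : ∀ {n} → Graph n → ℕ → Set
RepresentableBy {n} G k = ∃ λ (H : Hypergraph n) → Represents H G × length (arcs H) ≡ k

representableBy? : ∀ {n} (G : Graph n) → Decidable (RepresentableBy G)
representableBy? {n} G k =
  map′ (λ (L , len , o , u , rep) → record { arcs = L ; arcsOrd = o ; arcsUniq = u } , rep , len)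
       (λ (H , rep , len) → arcs H , len , arcsOrd H , arcsUniq H , rep)
       (anyOfLength? anyHyperarc? k representing?)
  where
  Representing : List (Hyperarc n) → Set
  Representing L = Σ (All (λ t → proj₁ t <ᶠ proj₁ (proj₂ t)) L) λ o → Σ (Unique L) λ u →
                   Represents (record { arcs = L ; arcsOrd = o ; arcsUniq = u }) G
  representing? : Decidable Representing
  representing? L with All.all? (λ t → proj₁ t <? proj₁ (proj₂ t)) L | unique? _≟ᴴ_ L
  ... | no ¬o | _     = no (¬o ∘ proj₁)
  ... | yes _ | no ¬u = no (¬u ∘ proj₁ ∘ proj₂)
  ... | yes o | yes u = map′ (λ rep → o , u , rep) (λ (_ , _ , rep) → Represents-resp-arcs {G = G} id id rep)
                             (represents? (record { arcs = L ; arcsOrd = o ; arcsUniq = u }) G)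

least-witness : ∀ {P : ℕ → Set} → Decidable P → ∀ {N} → P N → ∃ λ k → k ≤ N × P k × (∀ j → P j → k ≤ j)
least-witness {P} P? {N} = below N (<-wellFounded N)
  where
  below : ∀ N → Acc _<_ N → P N → ∃ λ k → k ≤ N × P k × (∀ j → P j → k ≤ j)
  below N (acc rec) pN with anyUpTo? P? N
  ... | no ¬smaller = N , ≤-refl , pN , λ j pj → ≮⇒≥ λ j<N → ¬smaller (j , j<N , pj)
  ... | yes (k , k<N , pk) with m , m≤k , pm , least ← below k (rec k<N) pk
    = m , ≤-trans m≤k (<⇒≤ k<N) , pm , least

hydraNumber-≤-size : ∀ {n} (G : Graph n) (H : Hypergraph n) → Represents H G →
                     ∃ λ h → IsHydraNumber G h × h ≤ length (arcs H)
hydraNumber-≤-size G H rep with h , h≤ , representable , least ← least-witness (representableBy? G) (H , rep , refl)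
  = h , (representable , λ H' rep' → least _ (H' , rep' , refl)) , h≤

-- The lower bound

body : ∀ {n} → Hyperarc n → Edge n
body t = proj₁ t , proj₁ (proj₂ t)

vertex-outside-pair : ∀ {n} → 3 ≤ n → (u v : Fin n) → ∃ λ z → ¬ Pair u v z
vertex-outside-pair (s≤s (s≤s (s≤s _))) zero          zero          = suc zero , [ (λ ()) , (λ ()) ]′
vertex-outside-pair (s≤s (s≤s (s≤s _))) zero          (suc zero)    = suc (suc zero) , [ (λ ()) , (λ ()) ]′
vertex-outside-pair (s≤s (s≤s (s≤s _))) zero          (suc (suc _)) = suc zero , [ (λ ()) , (λ ()) ]′
vertex-outside-pair (s≤s (s≤s (s≤s _))) (suc zero)    zero          = suc (suc zero) , [ (λ ()) , (λ ()) ]′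
vertex-outside-pair (s≤s (s≤s (s≤s _))) (suc zero)    (suc _)       = zero , [ (λ ()) , (λ ()) ]′
vertex-outside-pair (s≤s (s≤s (s≤s _))) (suc (suc _)) zero          = suc zero , [ (λ ()) , (λ ()) ]′
vertex-outside-pair (s≤s (s≤s (s≤s _))) (suc (suc _)) (suc _)       = zero , [ (λ ()) , (λ ()) ]′

edge-∈-bodies : ∀ {n} {G : Graph n} {H : Hypergraph n} → 3 ≤ n → Represents H G →
                ∀ {e} → e ∈ edges G → e ∈ map body (arcs H)
edge-∈-bodies {G = G} {H} 3≤n rep {u , v} e∈G with z , z∉uv ← vertex-outside-pair 3≤n u v
  with Closure-exit (pair? u v) (proj₁ (rep u v (<⇒≢ (All.lookup (ordered G) e∈G))) (inj₁ e∈G) z) z∉uv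
... | _ , _ , _ , t∈H , inj₁ refl , inj₂ refl , _ = ∈-map⁺ body t∈H
... | _ , _ , _ , t∈H , inj₂ refl , inj₁ refl , _ = ⊥-elim (<-asym (All.lookup (ordered G) e∈G) (All.lookup (arcsOrd H) t∈H))
... | _ , _ , _ , t∈H , inj₁ refl , inj₁ refl , _ = ⊥-elim (<-irrefl refl (All.lookup (arcsOrd H) t∈H))
... | _ , _ , _ , t∈H , inj₂ refl , inj₂ refl , _ = ⊥-elim (<-irrefl refl (All.lookup (arcsOrd H) t∈H))

hydra-lower-bound : ∀ {n} {G : Graph n} → 3 ≤ n → (H : Hypergraph n) → Represents H G → ∣E∣ G ≤ length (arcs H)
hydra-lower-bound {G = G} 3≤n H rep = ≤-trans (Unique-⊆⇒length≤ (unique G) (edge-∈-bodies {G = G} {H} 3≤n rep))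
                                              (≤-reflexive (length-map body (arcs H)))

edge-of-Fin2 : (e : Edge 2) → proj₁ e <ᶠ proj₂ e → e ≡ (zero , suc zero)
edge-of-Fin2 (zero     , suc zero) _        = refl
edge-of-Fin2 (zero     , zero)     ()
edge-of-Fin2 (suc zero , zero)     ()
edge-of-Fin2 (suc zero , suc zero) (s≤s ())

three-edges⇒three-vertices : ∀ {n} (G : Graph n) → 3 ≤ ∣E∣ G → 3 ≤ n
three-edges⇒three-vertices G = go (edges G) (ordered G) (unique G)
  where
  go : ∀ {n} (es : List (Edge n)) → All (λ e → proj₁ e <ᶠ proj₂ e) es → Unique es → 3 ≤ length es → 3 ≤ n
  go {suc (suc (suc _))} _                   _           _               _        = s≤s (s≤s (s≤s z≤n))
  go {0}                 ((() , _) ∷ _)      _           _               _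
  go {1}                 ((zero , zero) ∷ _) (() ∷ _)    _               _
  go {2}                 (e ∷ f ∷ _)         (e< ∷ f< ∷ _) ((e≢f ∷ _) ∷ _) _      =
    ⊥-elim (e≢f (trans (edge-of-Fin2 e e<) (sym (edge-of-Fin2 f f<))))
  go {2}                 (_ ∷ [])            _           _               (s≤s ())
  go                     []                  _           _               ()

-- Arcs carrying marks along a cyclic sequence of edges

module _ {n : ℕ} where

  arcsTowards : Edge n → Fin n → List (Hyperarc n)
  arcsTowards (a , b) x with pair? a b x
  ... | yes _ = []
  ... | no  _ = [ (a , b , x) ]

  propagate : Edge n → Edge n → List (Hyperarc n)
  propagate e (c , d) = arcsTowards e c ++ arcsTowards e d

  chainArcs : List (Edge n) → List (Hyperarc n)
  chainArcs (e ∷ f ∷ es) = propagate e f ++ chainArcs (f ∷ es)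
  chainArcs _            = []

  cycleArcs : List (Edge n) → List (Hyperarc n)
  cycleArcs []       = []
  cycleArcs (e ∷ es) = chainArcs ((e ∷ es) ∷ʳ e)

  arcsTowards-body : ∀ e x {t} → t ∈ arcsTowards e x → body t ≡ e
  arcsTowards-body (a , b) x t∈ with pair? a b x
  arcsTowards-body (a , b) x (here refl) | no _ = refl

  propagate-body : ∀ e f {t} → t ∈ propagate e f → body t ≡ e
  propagate-body e (c , d) t∈ = [ arcsTowards-body e c , arcsTowards-body e d ]′ (∈-++⁻ (arcsTowards e c) t∈)

  chainArcs-body : ∀ es {t} → t ∈ chainArcs es → body t ∈ es
  chainArcs-body (e ∷ f ∷ es) t∈ =
    [ here ∘ propagate-body e f , there ∘ chainArcs-body (f ∷ es) ]′ (∈-++⁻ (propagate e f) t∈)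

  cycleArcs-body : ∀ es {t} → t ∈ cycleArcs es → body t ∈ es
  cycleArcs-body (e ∷ es) t∈ with ∈-++⁻ (e ∷ es) (chainArcs-body ((e ∷ es) ∷ʳ e) t∈)
  ... | inj₁ b∈es       = b∈es
  ... | inj₂ (here b≡e) = here b≡e

  arcsTowards-length : ∀ e x → length (arcsTowards e x) ≤ 1
  arcsTowards-length (a , b) x with pair? a b x
  ... | yes _ = z≤n
  ... | no  _ = ≤-refl

  arcsTowards-endpoint : ∀ e x → Pair (proj₁ e) (proj₂ e) x → length (arcsTowards e x) ≡ 0
  arcsTowards-endpoint (a , b) x x∈e with pair? a b x
  ... | yes _   = refl
  ... | no  x∉e = ⊥-elim (x∉e x∈e)

  propagate-length : ∀ e f → length (propagate e f) ≤ 2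
  propagate-length e (c , d) = begin
    length (arcsTowards e c ++ arcsTowards e d)         ≡⟨ length-++ (arcsTowards e c) ⟩
    length (arcsTowards e c) + length (arcsTowards e d) ≤⟨ +-mono-≤ (arcsTowards-length e c) (arcsTowards-length e d) ⟩
    2                                                   ∎
    where open ≤-Reasoning

  propagate-adjacent-length : ∀ {e f} → LineAdj e f → length (propagate e f) ≤ 1
  propagate-adjacent-length {e} {c , d} (_ , shared) = begin
    length (arcsTowards e c ++ arcsTowards e d)         ≡⟨ length-++ (arcsTowards e c) ⟩
    length (arcsTowards e c) + length (arcsTowards e d) ≤⟨ bound (endpoint-of-e shared) ⟩
    1                                                   ∎
    where
    open ≤-Reasoning
    Endpoint = Pair (proj₁ e) (proj₂ e)
    endpoint-of-e : proj₁ e ≡ c ⊎ proj₁ e ≡ d ⊎ proj₂ e ≡ c ⊎ proj₂ e ≡ d → Endpoint c ⊎ Endpoint d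
    endpoint-of-e (inj₁ a≡c)               = inj₁ (inj₁ (sym a≡c))
    endpoint-of-e (inj₂ (inj₁ a≡d))        = inj₂ (inj₁ (sym a≡d))
    endpoint-of-e (inj₂ (inj₂ (inj₁ b≡c))) = inj₁ (inj₂ (sym b≡c))
    endpoint-of-e (inj₂ (inj₂ (inj₂ b≡d))) = inj₂ (inj₂ (sym b≡d))
    bound : Endpoint c ⊎ Endpoint d → length (arcsTowards e c) + length (arcsTowards e d) ≤ 1
    bound (inj₁ c∈e) = +-mono-≤ (≤-reflexive (arcsTowards-endpoint e c c∈e)) (arcsTowards-length e d)
    bound (inj₂ d∈e) = +-mono-≤ (arcsTowards-length e c) (≤-reflexive (arcsTowards-endpoint e d d∈e))

  chainArcs-++ : ∀ xs ys → length (chainArcs (xs ++ ys)) ≤ length (chainArcs xs) + 2 + length (chainArcs ys)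
  chainArcs-++ []           ys       = m≤n+m _ 2
  chainArcs-++ (x ∷ [])     []       = z≤n
  chainArcs-++ (x ∷ [])     (y ∷ ys) = begin
    length (propagate x y ++ chainArcs (y ∷ ys))            ≡⟨ length-++ (propagate x y) ⟩
    length (propagate x y) + length (chainArcs (y ∷ ys))    ≤⟨ +-monoˡ-≤ _ (propagate-length x y) ⟩
    2 + length (chainArcs (y ∷ ys))                         ∎
    where open ≤-Reasoning
  chainArcs-++ (x ∷ x' ∷ xs) ys = begin
    length (propagate x x' ++ chainArcs (x' ∷ xs ++ ys))              ≡⟨ length-++ (propagate x x') ⟩
    length (propagate x x') + length (chainArcs (x' ∷ xs ++ ys))      ≤⟨ +-monoʳ-≤ _ (chainArcs-++ (x' ∷ xs) ys) ⟩
    length (propagate x x') + (length (chainArcs (x' ∷ xs)) + 2 + length (chainArcs ys))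
                                                                      ≡⟨ regroup (length (propagate x x')) _ _ ⟩
    (length (propagate x x') + length (chainArcs (x' ∷ xs))) + 2 + length (chainArcs ys)
                                                                      ≡⟨ cong (λ m → m + 2 + length (chainArcs ys))
                                                                              (sym (length-++ (propagate x x'))) ⟩
    length (propagate x x' ++ chainArcs (x' ∷ xs)) + 2 + length (chainArcs ys) ∎
    where
    open ≤-Reasoning
    regroup : ∀ a b c → a + (b + 2 + c) ≡ a + b + 2 + c
    regroup = solve-∀

  chainArcs-linked : ∀ {x xs} → Linked LineAdj (x ∷ xs) → length (chainArcs (x ∷ xs)) ≤ length xs
  chainArcs-linked {xs = []}     _            = z≤n
  chainArcs-linked {x} {y ∷ ys} (x~y ∷ linked) = begin
    length (propagate x y ++ chainArcs (y ∷ ys))         ≡⟨ length-++ (propagate x y) ⟩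
    length (propagate x y) + length (chainArcs (y ∷ ys)) ≤⟨ +-mono-≤ (propagate-adjacent-length x~y) (chainArcs-linked linked) ⟩
    suc (length ys)                                      ∎
    where open ≤-Reasoning

  chainArcs-concat : ∀ {ps} h → All (Linked LineAdj) ps →
                     length (chainArcs (concat ps ∷ʳ h)) ≤ length (concat ps) + length ps
  chainArcs-concat {[]}            h []               = z≤n
  chainArcs-concat {[] ∷ ps}       h (_ ∷ linked)     =
    ≤-trans (chainArcs-concat h linked) (+-monoʳ-≤ (length (concat ps)) (n≤1+n (length ps)))
  chainArcs-concat {(x ∷ xs) ∷ ps} h (lp ∷ linked) = begin
    length (chainArcs (x ∷ (xs ++ concat ps) ++ [ h ]))                  ≡⟨ cong (length ∘ chainArcs ∘ (x ∷_))
                                                                                 (++-assoc xs (concat ps) [ h ]) ⟩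
    length (chainArcs ((x ∷ xs) ++ (concat ps ∷ʳ h)))                    ≤⟨ chainArcs-++ (x ∷ xs) _ ⟩
    length (chainArcs (x ∷ xs)) + 2 + length (chainArcs (concat ps ∷ʳ h)) ≤⟨ +-mono-≤ (+-monoˡ-≤ 2 (chainArcs-linked lp))
                                                                                   (chainArcs-concat h linked) ⟩
    length xs + 2 + (length (concat ps) + length ps)                     ≡⟨ regroup (length xs) _ _ ⟩
    suc (length xs + length (concat ps)) + suc (length ps)               ≡⟨ cong (λ m → suc m + suc (length ps))
                                                                                 (sym (length-++ xs)) ⟩
    suc (length (xs ++ concat ps)) + suc (length ps)                     ∎
    where
    open ≤-Reasoning
    regroup : ∀ a b c → a + 2 + (b + c) ≡ suc (a + b) + suc c
    regroup = solve-∀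

  cycleArcs-length : ∀ {k} es → (∀ h → length (chainArcs (es ∷ʳ h)) ≤ k) → length (cycleArcs es) ≤ k
  cycleArcs-length []       _     = z≤n
  cycleArcs-length (e ∷ es) bound = bound e

  cycleArcs-pathCover : ∀ {ps} → All (Linked LineAdj) ps →
                        length (cycleArcs (concat ps)) ≤ length (concat ps) + length ps
  cycleArcs-pathCover {ps} linked = cycleArcs-length (concat ps) (λ h → chainArcs-concat h linked)

  cycleArcs-hamiltonian : ∀ {x xs} → Linked LineAdj ((x ∷ xs) ∷ʳ x) → length (cycleArcs (x ∷ xs)) ≤ length (x ∷ xs)
  cycleArcs-hamiltonian {x} {xs} linked =
    ≤-trans (chainArcs-linked linked) (≤-reflexive (trans (length-++ xs) (+-comm (length xs) 1)))

module Marking {n : ℕ} (H : Hypergraph n) (S : Fin n → Set) where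

  Marked : Edge n → Set
  Marked e = Closure H S (proj₁ e) × Closure H S (proj₂ e)

  arcsTowards-marks : ∀ e x → arcsTowards e x ⊆ arcs H → Marked e → Closure H S x
  arcsTowards-marks (a , b) x ⊆H (ma , mb) with pair? a b x
  ... | yes (inj₁ refl) = ma
  ... | yes (inj₂ refl) = mb
  ... | no  _           = step (⊆H (here refl)) ma mb

  propagate-marks : ∀ e f → propagate e f ⊆ arcs H → Marked e → Marked f
  propagate-marks e (c , d) ⊆H me =
      arcsTowards-marks e c (⊆H ∘ xs⊆xs++ys _ _) me
    , arcsTowards-marks e d (⊆H ∘ xs⊆ys++xs _ (arcsTowards e c)) me

  chainArcs-marks-forward : ∀ e es → chainArcs (e ∷ es) ⊆ arcs H → Marked e → All Marked (e ∷ es)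
  chainArcs-marks-forward e []       _  me = me ∷ []
  chainArcs-marks-forward e (f ∷ es) ⊆H me =
    me ∷ chainArcs-marks-forward f es (⊆H ∘ xs⊆ys++xs _ (propagate e f))
                                      (propagate-marks e f (⊆H ∘ xs⊆xs++ys _ _) me)

  chainArcs-marks-last : ∀ es h → chainArcs (es ∷ʳ h) ⊆ arcs H → ∀ {e} → e ∈ es → Marked e → Marked h
  chainArcs-marks-last (x ∷ [])     h ⊆H (here refl) me = propagate-marks x h (⊆H ∘ xs⊆xs++ys _ _) me
  chainArcs-marks-last (x ∷ y ∷ es) h ⊆H (here refl) me =
    chainArcs-marks-last (y ∷ es) h (⊆H ∘ xs⊆ys++xs _ (propagate x y)) (here refl)
                         (propagate-marks x y (⊆H ∘ xs⊆xs++ys _ _) me)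
  chainArcs-marks-last (x ∷ y ∷ es) h ⊆H (there e∈) me =
    chainArcs-marks-last (y ∷ es) h (⊆H ∘ xs⊆ys++xs _ (propagate x y)) e∈ me

  cycleArcs-marks-all : ∀ es → cycleArcs es ⊆ arcs H → ∀ {e} → e ∈ es → Marked e → All Marked es
  cycleArcs-marks-all (x ∷ xs) ⊆H e∈ me =
    ++⁻ˡ (x ∷ xs) (chainArcs-marks-forward x (xs ∷ʳ x) ⊆H (chainArcs-marks-last (x ∷ xs) x ⊆H e∈ me))

-- The representing hypergraph

Closure-nonadjacent : ∀ {n} {G : Graph n} {H : Hypergraph n} → (∀ {t} → t ∈ arcs H → body t ∈ edges G) →
                      ∀ {u v} → ¬ Adjacent G u v → ∀ {x} → Closure H (Pair u v) x → Pair u v x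
Closure-nonadjacent bodies⊆G ¬adj (base uv) = uv
Closure-nonadjacent {G = G} {H} bodies⊆G ¬adj (step t∈H ca cb)
  with Closure-nonadjacent {G = G} {H} bodies⊆G ¬adj ca | Closure-nonadjacent {G = G} {H} bodies⊆G ¬adj cb
... | inj₁ refl | inj₁ refl = ⊥-elim (<-irrefl refl (All.lookup (arcsOrd H) t∈H))
... | inj₁ refl | inj₂ refl = ⊥-elim (¬adj (inj₁ (bodies⊆G t∈H)))
... | inj₂ refl | inj₁ refl = ⊥-elim (¬adj (inj₂ (bodies⊆G t∈H)))
... | inj₂ refl | inj₂ refl = ⊥-elim (<-irrefl refl (All.lookup (arcsOrd H) t∈H))

module Construction {n} (G G' : Graph n) (G'⊆G : SpanningSubgraph G G') (noIsolated' : NoIsolated G')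
                    (es : List (Edge n)) (es↭G' : es ↭ edges G') where

  shortcut : Edge n → Hyperarc n
  shortcut (a , b) = a , b , proj₁ (noIsolated' a)

  unspanned : List (Edge n)
  unspanned = filter (∁? (_∈ᴱ? edges G')) (edges G)

  arcList : List (Hyperarc n)
  arcList = cycleArcs es ++ map shortcut unspanned

  arcList-body : ∀ {t} → t ∈ arcList → body t ∈ edges G
  arcList-body t∈ with ∈-++⁻ (cycleArcs es) t∈
  ... | inj₁ t∈cycle = All.lookup G'⊆G (∈-resp-↭ es↭G' (cycleArcs-body es t∈cycle))
  ... | inj₂ t∈short with e , e∈ , refl ← ∈-map⁻ shortcut t∈short = proj₁ (∈-filter⁻ (∁? (_∈ᴱ? edges G')) e∈)

  H : Hypergraph n
  H = record
    { arcs     = deduplicate _≟ᴴ_ arcList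
    ; arcsOrd  = All.tabulate (λ t∈ → All.lookup (ordered G) (arcList-body (∈-deduplicate⁻ _≟ᴴ_ arcList t∈)))
    ; arcsUniq = deduplicate-! _≟ᴴ_ arcList
    }

  arcList⊆H : arcList ⊆ arcs H
  arcList⊆H = ∈-deduplicate⁺ _≟ᴴ_

  module _ (S : Fin n → Set) where
    open Marking H S

    marks-everything-from-G' : ∀ {e} → e ∈ edges G' → Marked e → ∀ x → Closure H S x
    marks-everything-from-G' e∈G' me x
      with cycleArcs-marks-all es (arcList⊆H ∘ xs⊆xs++ys _ _) (∈-resp-↭ (↭-sym es↭G') e∈G') me | noIsolated' x
    ... | all-marked | _ , inj₁ xw∈G' = proj₁ (All.lookup all-marked (∈-resp-↭ (↭-sym es↭G') xw∈G'))
    ... | all-marked | _ , inj₂ wx∈G' = proj₂ (All.lookup all-marked (∈-resp-↭ (↭-sym es↭G') wx∈G'))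

    marks-everything : ∀ {e} → e ∈ edges G → Marked e → ∀ x → Closure H S x
    marks-everything {a , b} e∈G me@(ma , mb) with (a , b) ∈ᴱ? edges G'
    ... | yes e∈G' = marks-everything-from-G' e∈G' me
    ... | no  e∉G' = [ (λ aw∈G' → marks-everything-from-G' aw∈G' (ma , mw))
                     , (λ wa∈G' → marks-everything-from-G' wa∈G' (mw , ma)) ]′ (proj₂ (noIsolated' a))
      where
      mw : Closure H S (proj₁ (noIsolated' a))
      mw = step (arcList⊆H (xs⊆ys++xs _ (cycleArcs es) (∈-map⁺ shortcut (∈-filter⁺ (∁? (_∈ᴱ? edges G')) e∈G e∉G'))))
                ma mb

  H-bodies : ∀ {t} → t ∈ arcs H → body t ∈ edges G
  H-bodies = arcList-body ∘ ∈-deduplicate⁻ _≟ᴴ_ arcList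

  represents : Represents H G
  represents u v _ = adjacent , λ ¬adj x → Closure-nonadjacent {G = G} {H} H-bodies ¬adj
    where
    adjacent : Adjacent G u v → ∀ x → Closure H (Pair u v) x
    adjacent (inj₁ uv∈G) = marks-everything (Pair u v) uv∈G (base (inj₁ refl) , base (inj₂ refl))
    adjacent (inj₂ vu∈G) = marks-everything (Pair u v) vu∈G (base (inj₂ refl) , base (inj₁ refl))

  spanned : List (Edge n)
  spanned = filter (_∈ᴱ? edges G') (edges G)

  ∣E∣G'≤spanned : ∣E∣ G' ≤ length spanned
  ∣E∣G'≤spanned = Unique-⊆⇒length≤ (unique G') λ e∈G' → ∈-filter⁺ (_∈ᴱ? edges G') (All.lookup G'⊆G e∈G') e∈G'

  size : length (arcs H) + length es ≤ ∣E∣ G + length (cycleArcs es)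
  size = begin
    length (arcs H) + length es                                 ≤⟨ +-mono-≤ (length-deduplicate _≟ᴴ_ arcList)
                                                                            (≤-trans (≤-reflexive (↭-length es↭G')) ∣E∣G'≤spanned) ⟩
    length arcList + length spanned                             ≡⟨ cong (_+ length spanned) length-arcList ⟩
    (length (cycleArcs es) + length unspanned) + length spanned ≡⟨ regroup (length (cycleArcs es)) _ _ ⟩
    (length spanned + length unspanned) + length (cycleArcs es) ≡⟨ cong (_+ length (cycleArcs es))
                                                                        (length-filter+length-filter-∁ (_∈ᴱ? edges G') (edges G)) ⟩
    ∣E∣ G + length (cycleArcs es)                               ∎
    where
    open ≤-Reasoning
    length-arcList : length arcList ≡ length (cycleArcs es) + length unspanned
    length-arcList = trans (length-++ (cycleArcs es)) (cong (length (cycleArcs es) +_) (length-map shortcut unspanned))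
    regroup : ∀ c u s → c + u + s ≡ s + u + c
    regroup = solve-∀

cancel-cycle-cost : ∀ {a es E c k : ℕ} → a + es ≤ E + c → c ≤ es + k → a ≤ E + k
cancel-cycle-cost {a} {es} {E} {c} {k} size c≤ = +-cancelʳ-≤ es a (E + k) (begin
  a + es       ≤⟨ size ⟩
  E + c        ≤⟨ +-monoʳ-≤ E c≤ ⟩
  E + (es + k) ≡⟨ regroup E es k ⟩
  E + k + es   ∎)
  where
  open ≤-Reasoning
  regroup : ∀ E es k → E + (es + k) ≡ E + k + es
  regroup = solve-∀

module _ {n} (G G' : Graph n) (G'⊆G : SpanningSubgraph G G') (noIsolated' : NoIsolated G') where

  pathCover⇒representation : ∀ {k} → PathCover (edges G') LineAdj k →
                             ∃ λ H → Represents H G × length (arcs H) ≤ ∣E∣ G + k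
  pathCover⇒representation (ps , refl , _ , linked , ps↭G') =
    H , represents , cancel-cycle-cost size (cycleArcs-pathCover linked)
    where open Construction G G' G'⊆G noIsolated' (concat ps) ps↭G'

  hamiltonian⇒representation : HamiltonianLine G' → ∃ λ H → Represents H G × length (arcs H) ≤ ∣E∣ G
  hamiltonian⇒representation (x , xs , cycle↭G' , _ , linked) =
    H , represents , ≤-trans (cancel-cycle-cost size (≤-trans (cycleArcs-hamiltonian linked) (m≤m+n _ 0)))
                             (≤-reflexive (+-identityʳ (∣E∣ G)))
    where open Construction G G' G'⊆G noIsolated' (x ∷ xs) cycle↭G'

hamiltonian⇒three-vertices : ∀ {n} (G' : Graph n) → HamiltonianLine G' → 3 ≤ n
hamiltonian⇒three-vertices G' (_ , _ , cycle↭G' , 3≤cycle , _) =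
  three-edges⇒three-vertices G' (≤-trans 3≤cycle (≤-reflexive (↭-length cycle↭G')))

theorem4p2 : ∀ {n} (G : Graph n) → NoIsolated G →
    ((p : ℕ) → IsP G p → ∃ λ h → IsHydraNumber G h × h ≤ ∣E∣ G + p)
    × ((∃ λ G' → SpanningSubgraph G G' × NoIsolated G' × HamiltonianLine G')
       → IsHydraNumber G (∣E∣ G))
-- No hypothesis on G itself is needed: the spanning subgraph G' has no isolated vertices.
theorem4p2 G _ = upper-bound , single-headed
  where
  upper-bound : (p : ℕ) → IsP G p → ∃ λ h → IsHydraNumber G h × h ≤ ∣E∣ G + p
  upper-bound p ((G' , G'⊆G , noIsolated' , cover , _) , _)
    with H , rep , H≤E+p ← pathCover⇒representation G G' G'⊆G noIsolated' cover
    with h , hydra , h≤H ← hydraNumber-≤-size G H rep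
    = h , hydra , ≤-trans h≤H H≤E+p

  single-headed : (∃ λ G' → SpanningSubgraph G G' × NoIsolated G' × HamiltonianLine G') → IsHydraNumber G (∣E∣ G)
  single-headed (G' , G'⊆G , noIsolated' , ham)
    with H , rep , H≤E ← hamiltonian⇒representation G G' G'⊆G noIsolated' ham
    = (H , rep , ≤-antisym H≤E (lower H rep)) , lower
    where lower = hydra-lower-bound {G = G} (hamiltonian⇒three-vertices G' ham)
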